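{- Let $n\ge2$ and let $f$ be the $n$-ary operation on $\mathbb{Z}_8$ given by $f=2x_1\cdots x_n\left(\sum_{i=1}^n a_ix_i^2+\sum_{i=1}^n b_ix_i+c\right)$ with $a_i,b_i\in\{0,1\}$ and $c\in\{0,1,2,3\}$. Then $\sum_{i}a_i+\sum_i b_i+c$ is even if and only if $f$ preserves the relation $M=\{\mathbf{x}\in Z\mid a_{\{1,3\}}\equiv0\pmod 4\}$.
   Context: Let $P_4$ be the power set of $\{1,2,3,4\}$; tuples in $\mathbb{Z}_8^{P_4}$ are written $\mathbf{x}=(x_A\mid A\in P_4)$. For $A\in P_4$ let $\mathbf{g}^A$ have $g^A_B=1$ if $A\subseteq B$ and $0$ otherwise. Every $\mathbf{x}$ is uniquely $\mathbf{x}=\sum_A a_A\mathbf{g}^A$ with $a_A\in\mathbb{Z}_8$ (namely $a_A=(-1)^{|A|}\sum_{B\subseteq A}(-1)^{|B|}x_B$); these $a_A$ are the coordinates of $\mathbf{x}$. $Z$ is the set of $\mathbf{x}\in\mathbb{Z}_8^{P_4}$ whose coordinates satisfy: (Z1) $a_{\{2\}}\equiv 2a_{\{1\}}$ and $a_{\{4\}}\equiv 2a_{\{3\}}\pmod 4$; (Z2) $a_A\equiv0\pmod 2$ whenever $|A|\ge2$; (Z3) $a_A\equiv0\pmod4$ whenever $|A|\ge2$ and $A\cap\{2,4\}\ne\emptyset$; (Z4) $a_A=0$ whenever $\{2,4\}\subseteq A$. An $n$-ary operation preserves a relation $R\subseteq\mathbb{Z}_8^{P_4}$ if applying it componentwise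 to any $n$ tuples of $R$ yields a tuple of $R$. -}

module Defs where

open import Data.Bool using (Bool; true; false; _∧_; if_then_else_; not)
open import Data.Nat as ℕ using (ℕ; zero; suc; _≤_)
open import Data.Nat.DivMod using (_%_)
open import Data.Fin using (Fin; toℕ; fromℕ<)
open import Data.Fin.Subset using (Subset; ⁅_⁆; _∪_; _∩_; _⊆_; ∣_∣; Nonempty)
open import Data.Vec using (Vec; []; _∷_)
open import Data.List using (List; []; _∷_; map; _++_; filter)
open import Data.Integer as ℤ using (ℤ; +_; -_)
open import Data.Integer.Divisibility using (_∣_)
open import Data.Product using (_×_)
open import Data.Sum using (_⊎_)
open import Relation.Binary.PropositionalEquality using (_≡_)
open import Relation.Nullary.Decidable using (Dec; yes; no)

ℤ₈ : Set
ℤ₈ = Fin 8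

-- P₄ : the power set of {1,2,3,4}; element k ∈ {1,2,3,4} is the Fin 4 index k-1
P₄ : Set
P₄ = Subset 4

Tuple : Set
Tuple = P₄ → ℤ₈

allSubsets : (n : ℕ) → List (Subset n)
allSubsets zero = [] ∷ []
allSubsets (suc n) = map (true ∷_) (allSubsets n) ++ map (false ∷_) (allSubsets n)

_⊆ᵇ_ : ∀ {n} → Subset n → Subset n → Bool
[] ⊆ᵇ [] = true
(true ∷ p) ⊆ᵇ (false ∷ q) = false
(_ ∷ p) ⊆ᵇ (_ ∷ q) = p ⊆ᵇ q

sign : ℕ → ℤ
sign k = if (k % 2 ℕ.≡ᵇ 0) then + 1 else - (+ 1)

sumℤ : List ℤ → ℤ
sumℤ [] = + 0
sumℤ (z ∷ zs) = z ℤ.+ sumℤ zs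

coord : Tuple → P₄ → ℤ
coord x A = sign ∣ A ∣ ℤ.* sumℤ (map (λ B → if B ⊆ᵇ A then sign ∣ B ∣ ℤ.* (+ toℕ (x B)) else + 0) (allSubsets 4))

e1 e2 e3 e4 : Fin 4
e1 = Data.Fin.zero
e2 = Data.Fin.suc Data.Fin.zero
e3 = Data.Fin.suc (Data.Fin.suc Data.Fin.zero)
e4 = Data.Fin.suc (Data.Fin.suc (Data.Fin.suc Data.Fin.zero))

_≡[mod_]_ : ℤ → ℕ → ℤ → Set
infix 4 _≡[mod_]_
a ≡[mod m ] b = (+ m) ∣ (a ℤ.- b)

InZ : Tuple → Set
InZ x =
  -- (Z1)
  ((coord x ⁅ e2 ⁆ ≡[mod 4 ] (+ 2 ℤ.* coord x ⁅ e1 ⁆)) ×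
   (coord x ⁅ e4 ⁆ ≡[mod 4 ] (+ 2 ℤ.* coord x ⁅ e3 ⁆))) ×
  -- (Z2)
  (∀ (A : P₄) → 2 ≤ ∣ A ∣ → coord x A ≡[mod 2 ] (+ 0)) ×
  -- (Z3)
  (∀ (A : P₄) → 2 ≤ ∣ A ∣ → Nonempty (A ∩ (⁅ e2 ⁆ ∪ ⁅ e4 ⁆)) → coord x A ≡[mod 4 ] (+ 0)) ×
  -- (Z4) (a_A = 0 in ℤ₈)
  (∀ (A : P₄) → (⁅ e2 ⁆ ∪ ⁅ e4 ⁆) ⊆ A → coord x A ≡[mod 8 ] (+ 0))

InM : Tuple → Set
InM x = InZ x × (coord x (⁅ e1 ⁆ ∪ ⁅ e3 ⁆) ≡[mod 4 ] (+ 0))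

Op : ℕ → Set
Op n = (Fin n → ℤ₈) → ℤ₈

Preserves : ∀ {n} → Op n → (Tuple → Set) → Set
Preserves {n} f R = (r : Fin n → Tuple) → (∀ i → R (r i)) → R (λ A → f (λ i → r i A))

Σℕ : ∀ {n} → (Fin n → ℕ) → ℕ
Σℕ {zero} g = 0
Σℕ {suc n} g = g Data.Fin.zero ℕ.+ Σℕ (λ i → g (Data.Fin.suc i))

Πℕ : ∀ {n} → (Fin n → ℕ) → ℕ
Πℕ {zero} g = 1
Πℕ {suc n} g = g Data.Fin.zero ℕ.* Πℕ (λ i → g (Data.Fin.suc i))

toℤ₈ : ℕ → ℤ₈
toℤ₈ m = fromℕ< (Data.Nat.DivMod.m%n<n m 8)

fOp : (n : ℕ) → (a b : Fin n → Fin 2) → (c : Fin 4) → Op n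
fOp n a b c x = toℤ₈ (2 ℕ.* Πℕ (λ i → toℕ (x i)) ℕ.*
  (Σℕ (λ i → toℕ (a i) ℕ.* toℕ (x i) ℕ.* toℕ (x i)) ℕ.+ Σℕ (λ i → toℕ (b i) ℕ.* toℕ (x i)) ℕ.+ toℕ c))

{-# OPTIONS --safe #-}
-- The Möbius coordinates a_A of a tuple are iterated finite differences of its entries.
-- For x ∈ Z the restriction of x to each face {t₁} × {0,1} × {t₃} × {0,1} is graded: its
-- first differences in the directions 2 and 4 are even and its mixed second difference is
-- divisible by 4. Graded squares are closed under sums and products, so f, being twice an
-- integer polynomial, has mixed second differences divisible by 8 on every face; this is
-- (Z4) for the output. If Σaᵢ + Σbᵢ + c is even, then x₁⋯xₙ (Σaᵢxᵢ² + Σbᵢxᵢ + c) is even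
-- for all arguments (if all xᵢ are odd it is ≡ Σaᵢ + Σbᵢ + c mod 2), so every entry of
-- the output is divisible by 4, which gives (Z1)–(Z3) and a_{1,3} ≡ 0 mod 4. Conversely,
-- f applied to the tuples B ↦ [1 ∈ B] + 2[2 ∈ B], B ↦ [3 ∈ B] + 2[4 ∈ B] and B ↦ 1, all
-- in M, yields a tuple whose coordinate a_{1,3} is 2(Σaᵢ + Σbᵢ + c) mod 8.
module Submission where

open import Defs
open import Data.Bool using (Bool; true; false; if_then_else_)
open import Data.Empty using (⊥-elim)
open import Data.Fin using (Fin; toℕ) renaming (zero to fzero; suc to fsuc)
open import Data.Fin.Properties using (any?; toℕ-fromℕ<)
open import Data.Fin.Subset using (Subset; ∣_∣; ⁅_⁆; _∪_; _⊆_)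
open import Data.Fin.Subset.Properties using (anySubset?; nonempty?; _⊆?_)
open import Data.Integer as ℤ using (ℤ; +_)
open import Data.Integer.Properties
  using (+-identityˡ; +-identityʳ; *-identityˡ; +-assoc; neg-distrib-+; neg-distribˡ-*; pos-*)
open import Data.Integer.Tactic.RingSolver using (solve-∀)
open import Data.List using (List; []; _∷_; map; _++_)
open import Data.List.Properties using (map-++; map-∘; map-cong)
open import Data.Nat as ℕ using (ℕ; zero; suc; _≤_; _≤?_; z≤n; s≤s; _%_; _/_; NonZero)
open import Data.Nat.DivMod using (%-distribˡ-+; %-distribˡ-*; m%n%n≡m%n; m≡m%n+[m/n]*n)
import Data.Nat.Divisibility as ℕ
import Data.Nat.Properties as ℕ
open import Data.Product using (_,_; proj₁; proj₂)
open import Data.Vec using ([]; _∷_; here; there)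
open import Function using (_∘_)
open import Relation.Binary.PropositionalEquality
open import Relation.Nullary using (¬_; yes; no)
open import Relation.Nullary.Decidable
  using (Dec; map′; ¬?; _×-dec_; _→-dec_; decidable-stable; from-yes)

module MöbiusCoordinates where

  open import Data.Integer using (_+_; _-_; _*_; -_)
  open import Data.Integer.Divisibility.Signed using (_∣_; ∣m∣n⇒∣m-n; ∣m+n∣n⇒∣m; ∣m⇒∣-m)

  möbius : ∀ {n} → (Subset n → ℤ) → Subset n → ℤ
  möbius {zero}  v []          = v []
  möbius {suc n} v (false ∷ A) = möbius (v ∘ (false ∷_)) A
  möbius {suc n} v (true ∷ A)  = möbius (v ∘ (true ∷_)) A - möbius (v ∘ (false ∷_)) A

  summand : ∀ {n} → (Subset n → ℤ) → Subset n → Subset n → ℤ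
  summand v A B = if B ⊆ᵇ A then sign ∣ B ∣ * v B else + 0

  -- coord x is alternatingSum applied to the entries of x by definition; stating the
  -- formula for Subset n makes it amenable to induction on n.
  alternatingSum : ∀ {n} → (Subset n → ℤ) → Subset n → ℤ
  alternatingSum {n} v A = sign ∣ A ∣ * sumℤ (map (summand v A) (allSubsets n))

  sign-suc : ∀ k → sign (suc k) ≡ - sign k
  sign-suc zero          = refl
  sign-suc (suc zero)    = refl
  sign-suc (suc (suc k)) = sign-suc k

  sumℤ-++ : ∀ xs ys → sumℤ (xs ++ ys) ≡ sumℤ xs + sumℤ ys
  sumℤ-++ []       ys = sym (+-identityˡ _)
  sumℤ-++ (x ∷ xs) ys = trans (cong (_+_ x) (sumℤ-++ xs ys)) (sym (+-assoc x _ _))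

  sumℤ-zero : ∀ {A : Set} (xs : List A) → sumℤ (map (λ _ → + 0) xs) ≡ + 0
  sumℤ-zero []       = refl
  sumℤ-zero (x ∷ xs) = trans (+-identityˡ _) (sumℤ-zero xs)

  sumℤ-neg : ∀ {A : Set} (f : A → ℤ) xs → sumℤ (map (λ a → - f a) xs) ≡ - sumℤ (map f xs)
  sumℤ-neg f []       = refl
  sumℤ-neg f (x ∷ xs) = trans (cong (_+_ (- f x)) (sumℤ-neg f xs)) (sym (neg-distrib-+ (f x) _))

  sumℤ-allSubsets-suc : ∀ {n} (f : Subset (suc n) → ℤ) →
    sumℤ (map f (allSubsets (suc n)))
      ≡ sumℤ (map (f ∘ (true ∷_)) (allSubsets n)) + sumℤ (map (f ∘ (false ∷_)) (allSubsets n))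
  sumℤ-allSubsets-suc {n} f = begin
    sumℤ (map f (map (true ∷_) L ++ map (false ∷_) L))
      ≡⟨ cong sumℤ (map-++ f (map (true ∷_) L) _) ⟩
    sumℤ (map f (map (true ∷_) L) ++ map f (map (false ∷_) L))
      ≡⟨ sumℤ-++ (map f (map (true ∷_) L)) _ ⟩
    sumℤ (map f (map (true ∷_) L)) + sumℤ (map f (map (false ∷_) L))
      ≡⟨ sym (cong₂ (λ p q → sumℤ p + sumℤ q) (map-∘ L) (map-∘ L)) ⟩
    sumℤ (map (f ∘ (true ∷_)) L) + sumℤ (map (f ∘ (false ∷_)) L) ∎
    where
    open ≡-Reasoning
    L = allSubsets n

  private
    summand-true : ∀ {n} (v : Subset (suc n) → ℤ) A B →
                   summand v (true ∷ A) (true ∷ B) ≡ - summand (v ∘ (true ∷_)) A B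
    summand-true v A B with B ⊆ᵇ A
    ... | true  = trans (cong (_* v (true ∷ B)) (sign-suc ∣ B ∣))
                        (sym (neg-distribˡ-* (sign ∣ B ∣) (v (true ∷ B))))
    ... | false = refl

  alternatingSum≡möbius : ∀ {n} (v : Subset n → ℤ) A → alternatingSum v A ≡ möbius v A
  alternatingSum≡möbius {zero} v [] = trans (*-identityˡ _) (trans (+-identityʳ _) (*-identityˡ _))
  alternatingSum≡möbius {suc n} v (false ∷ A) = begin
    sign ∣ A ∣ * sumℤ (map (summand v (false ∷ A)) (allSubsets (suc n)))
      ≡⟨ cong (sign ∣ A ∣ *_) (sumℤ-allSubsets-suc (summand v (false ∷ A))) ⟩
    sign ∣ A ∣ * (sumℤ (map (λ _ → + 0) (allSubsets n)) + S)
      ≡⟨ cong (λ s → sign ∣ A ∣ * (s + S)) (sumℤ-zero (allSubsets n)) ⟩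
    sign ∣ A ∣ * (+ 0 + S)
      ≡⟨ cong (sign ∣ A ∣ *_) (+-identityˡ S) ⟩
    alternatingSum (v ∘ (false ∷_)) A
      ≡⟨ alternatingSum≡möbius (v ∘ (false ∷_)) A ⟩
    möbius v (false ∷ A) ∎
    where
    open ≡-Reasoning
    S = sumℤ (map (summand (v ∘ (false ∷_)) A) (allSubsets n))
  alternatingSum≡möbius {suc n} v (true ∷ A) = begin
    sign (suc ∣ A ∣) * sumℤ (map (summand v (true ∷ A)) (allSubsets (suc n)))
      ≡⟨ cong₂ _*_ (sign-suc ∣ A ∣) (sumℤ-allSubsets-suc (summand v (true ∷ A))) ⟩
    - sign ∣ A ∣ * (sumℤ (map (summand v (true ∷ A) ∘ (true ∷_)) L) + S false)
      ≡⟨ cong (λ s → - sign ∣ A ∣ * (s + S false))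
              (trans (cong sumℤ (map-cong (summand-true v A) L)) (sumℤ-neg _ L)) ⟩
    - sign ∣ A ∣ * (- S true + S false)
      ≡⟨ distrib (sign ∣ A ∣) (S true) (S false) ⟩
    alternatingSum (v ∘ (true ∷_)) A - alternatingSum (v ∘ (false ∷_)) A
      ≡⟨ cong₂ _-_ (alternatingSum≡möbius (v ∘ (true ∷_)) A)
                   (alternatingSum≡möbius (v ∘ (false ∷_)) A) ⟩
    möbius v (true ∷ A) ∎
    where
    open ≡-Reasoning
    L = allSubsets n
    S : Bool → ℤ
    S t = sumℤ (map (summand (v ∘ (t ∷_)) A) L)
    distrib : ∀ s p q → - s * (- p + q) ≡ s * p - s * q
    distrib = solve-∀

  module _ {k : ℤ} where

    restrict-∣ : ∀ {n} (v : Subset (suc n) → ℤ) A → (∀ b → k ∣ möbius v (b ∷ A)) →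
                 ∀ t → k ∣ möbius (v ∘ (t ∷_)) A
    restrict-∣ v A k∣ false = k∣ false
    restrict-∣ v A k∣ true  = ∣m+n∣n⇒∣m (k∣ true) (∣m⇒∣-m (k∣ false))

    extend-∣ : ∀ {n} (v : Subset (suc n) → ℤ) A → (∀ t → k ∣ möbius (v ∘ (t ∷_)) A) →
               ∀ b → k ∣ möbius v (b ∷ A)
    extend-∣ v A k∣ false = k∣ false
    extend-∣ v A k∣ true  = ∣m∣n⇒∣m-n (k∣ true) (k∣ false)

    entries-∣ : ∀ {n} (v : Subset n → ℤ) → (∀ A → k ∣ möbius v A) → ∀ B → k ∣ v B
    entries-∣ {zero}  v k∣ []      = k∣ []
    entries-∣ {suc n} v k∣ (t ∷ B) =
      entries-∣ (v ∘ (t ∷_)) (λ A → restrict-∣ v A (λ b → k∣ (b ∷ A)) t) B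

    coordinates-∣ : ∀ {n} (v : Subset n → ℤ) → (∀ B → k ∣ v B) → ∀ A → k ∣ möbius v A
    coordinates-∣ {zero}  v k∣ []      = k∣ []
    coordinates-∣ {suc n} v k∣ (b ∷ A) =
      extend-∣ v A (λ t → coordinates-∣ (v ∘ (t ∷_)) (λ B → k∣ (t ∷ B)) A) b

  Δ : ∀ {n} → (Subset (suc n) → ℤ) → Subset n → ℤ
  Δ v B = v (true ∷ B) - v (false ∷ B)

  private
    fix₁ : ∀ {n} → Bool → (Subset (suc (suc n)) → ℤ) → Subset (suc n) → ℤ
    fix₁ t v (b ∷ B) = v (b ∷ t ∷ B)

  möbius-Δ : ∀ {n} (v : Subset (suc n) → ℤ) A → möbius (Δ v) A ≡ möbius v (true ∷ A)
  möbius-Δ {zero}  v []          = refl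
  möbius-Δ {suc n} v (false ∷ A) = möbius-Δ (fix₁ false v) A
  möbius-Δ {suc n} v (true ∷ A)  =
    trans (cong₂ _-_ (möbius-Δ (fix₁ true v) A) (möbius-Δ (fix₁ false v) A))
          (interchange (m true true) (m false true) (m true false) (m false false))
    where
    m : Bool → Bool → ℤ
    m t s = möbius (λ B → v (t ∷ s ∷ B)) A
    interchange : ∀ a b c d → (a - b) - (c - d) ≡ (a - c) - (b - d)
    interchange = solve-∀

  Δ-∣ : ∀ {k n} (v : Subset (suc n) → ℤ) → (∀ A → k ∣ möbius v (true ∷ A)) → ∀ B → k ∣ Δ v B
  Δ-∣ v k∣ = entries-∣ (Δ v) (λ A → subst (_ ∣_) (sym (möbius-Δ v A)) (k∣ A))

open MöbiusCoordinates

module GradedSquares where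

  open import Data.Integer using (_+_; _-_; _*_)
  open import Data.Integer.Divisibility.Signed using (_∣_; divides)

  δ² : ℤ → ℤ → ℤ → ℤ → ℤ
  δ² q₀₀ q₁₀ q₀₁ q₁₁ = (q₁₁ - q₀₁) - (q₁₀ - q₀₀)

  -- The values at 00, 10, 01, 11 of a function on {0,1}² whose Möbius coordinates lie in
  -- ℤ, 2ℤ, 2ℤ and 4ℤ.
  data Graded : ℤ → ℤ → ℤ → ℤ → Set where
    graded : ∀ q l m j → Graded q (q + l * + 2) (q + m * + 2) (q + l * + 2 + m * + 2 + j * + 4)

  graded-≡ : ∀ {q₀₀ q₁₀ q₀₁ q₁₁} l m j → q₁₀ ≡ q₀₀ + l * + 2 → q₀₁ ≡ q₀₀ + m * + 2 →
             q₁₁ ≡ q₀₀ + l * + 2 + m * + 2 + j * + 4 → Graded q₀₀ q₁₀ q₀₁ q₁₁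
  graded-≡ l m j refl refl refl = graded _ l m j

  graded-from-∣ : ∀ {q₀₀ q₁₀ q₀₁ q₁₁} → + 2 ∣ q₁₀ - q₀₀ → + 2 ∣ q₀₁ - q₀₀ →
                  + 4 ∣ δ² q₀₀ q₁₀ q₀₁ q₁₁ → Graded q₀₀ q₁₀ q₀₁ q₁₁
  graded-from-∣ {q₀₀} {q₁₀} {q₀₁} {q₁₁} (divides l eq₁₀) (divides m eq₀₁) (divides j eq₁₁) =
    graded-≡ l m j (trans (split q₁₀ q₀₀) (cong (_+_ q₀₀) eq₁₀))
                   (trans (split q₀₁ q₀₀) (cong (_+_ q₀₀) eq₀₁))
      (trans (corner q₀₀ q₁₀ q₀₁ q₁₁) (cong₂ _+_ (cong₂ _+_ (cong (_+_ q₀₀) eq₁₀) eq₀₁) eq₁₁))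
    where
    split : ∀ a b → a ≡ b + (a - b)
    split = solve-∀
    corner : ∀ q₀₀ q₁₀ q₀₁ q₁₁ →
             q₁₁ ≡ q₀₀ + (q₁₀ - q₀₀) + (q₀₁ - q₀₀) + ((q₁₁ - q₀₁) - (q₁₀ - q₀₀))
    corner = solve-∀

  graded-const : ∀ c → Graded c c c c
  graded-const c = graded-≡ (+ 0) (+ 0) (+ 0) (edge c) (edge c) (corner c)
    where
    edge : ∀ c → c ≡ c + + 0 * + 2
    edge = solve-∀
    corner : ∀ c → c ≡ c + + 0 * + 2 + + 0 * + 2 + + 0 * + 4
    corner = solve-∀

  graded-+ : ∀ {q₀₀ q₁₀ q₀₁ q₁₁ r₀₀ r₁₀ r₀₁ r₁₁} → Graded q₀₀ q₁₀ q₀₁ q₁₁ → Graded r₀₀ r₁₀ r₀₁ r₁₁ →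
             Graded (q₀₀ + r₀₀) (q₁₀ + r₁₀) (q₀₁ + r₀₁) (q₁₁ + r₁₁)
  graded-+ (graded q l m j) (graded r l′ m′ j′) =
    graded-≡ (l + l′) (m + m′) (j + j′) (edge q l r l′) (edge q m r m′) (corner q l m j r l′ m′ j′)
    where
    edge : ∀ q l r l′ → (q + l * + 2) + (r + l′ * + 2) ≡ (q + r) + (l + l′) * + 2
    edge = solve-∀
    corner : ∀ q l m j r l′ m′ j′ →
      (q + l * + 2 + m * + 2 + j * + 4) + (r + l′ * + 2 + m′ * + 2 + j′ * + 4)
        ≡ (q + r) + (l + l′) * + 2 + (m + m′) * + 2 + (j + j′) * + 4
    corner = solve-∀

  graded-* : ∀ {q₀₀ q₁₀ q₀₁ q₁₁ r₀₀ r₁₀ r₀₁ r₁₁} → Graded q₀₀ q₁₀ q₀₁ q₁₁ → Graded r₀₀ r₁₀ r₀₁ r₁₁ →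
             Graded (q₀₀ * r₀₀) (q₁₀ * r₁₀) (q₀₁ * r₀₁) (q₁₁ * r₁₁)
  graded-* (graded q l m j) (graded r l′ m′ j′) =
    graded-≡ (q * l′ + l * r + + 2 * l * l′) (q * m′ + m * r + + 2 * m * m′)
             (q * j′ + j * r + (l + m + + 2 * j) * (l′ + m′ + + 2 * j′) - l * l′ - m * m′)
             (edge q l r l′) (edge q m r m′) (corner q l m j r l′ m′ j′)
    where
    edge : ∀ q l r l′ → (q + l * + 2) * (r + l′ * + 2) ≡ q * r + (q * l′ + l * r + + 2 * l * l′) * + 2
    edge = solve-∀
    corner : ∀ q l m j r l′ m′ j′ →
      (q + l * + 2 + m * + 2 + j * + 4) * (r + l′ * + 2 + m′ * + 2 + j′ * + 4)
        ≡ q * r + (q * l′ + l * r + + 2 * l * l′) * + 2 + (q * m′ + m * r + + 2 * m * m′) * + 2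
            + (q * j′ + j * r + (l + m + + 2 * j) * (l′ + m′ + + 2 * j′) - l * l′ - m * m′) * + 4
    corner = solve-∀

  8∣δ²-double : ∀ {q₀₀ q₁₀ q₀₁ q₁₁} → Graded q₀₀ q₁₀ q₀₁ q₁₁ →
                + 8 ∣ δ² (+ 2 * q₀₀) (+ 2 * q₁₀) (+ 2 * q₀₁) (+ 2 * q₁₁)
  8∣δ²-double (graded q l m j) = divides j (second q l m j)
    where
    second : ∀ q l m j → (+ 2 * (q + l * + 2 + m * + 2 + j * + 4) - + 2 * (q + m * + 2))
                           - (+ 2 * (q + l * + 2) - + 2 * q) ≡ j * + 8
    second = solve-∀

open GradedSquares

module ValuesOfF where

  open import Data.Nat using (_+_; _*_)
  open import Data.Nat.Divisibility using (_∣_; _∣?_; divides; ∣-refl; ∣m⇒∣m*n; ∣n⇒∣m*n; ∣m∣n⇒∣m+n;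
                                           m%n≡0⇒n∣m; n∣m⇒m%n≡0)

  quadratic : ∀ {n} → (a b : Fin n → ℕ) → ℕ → (Fin n → ℕ) → ℕ
  quadratic a b c x = Σℕ (λ i → a i * x i * x i) + Σℕ (λ i → b i * x i) + c

  %2≡1-if-odd : ∀ m → ¬ 2 ∣ m → m % 2 ≡ 1
  %2≡1-if-odd zero          2∤0   = ⊥-elim (2∤0 (divides 0 refl))
  %2≡1-if-odd (suc zero)    _     = refl
  %2≡1-if-odd (suc (suc m)) 2∤2+m = %2≡1-if-odd m (2∤2+m ∘ ∣m∣n⇒∣m+n ∣-refl)

  +-cong-% : ∀ d .{{_ : NonZero d}} m m′ n n′ → m % d ≡ m′ % d → n % d ≡ n′ % d →
             (m + n) % d ≡ (m′ + n′) % d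
  +-cong-% d m m′ n n′ m≡m′ n≡n′ = begin
    (m + n) % d             ≡⟨ %-distribˡ-+ m n d ⟩
    (m % d + n % d) % d     ≡⟨ cong₂ (λ p q → (p + q) % d) m≡m′ n≡n′ ⟩
    (m′ % d + n′ % d) % d   ≡⟨ %-distribˡ-+ m′ n′ d ⟨
    (m′ + n′) % d           ∎
    where open ≡-Reasoning

  Σℕ-cong-% : ∀ {n} d .{{_ : NonZero d}} (f g : Fin n → ℕ) → (∀ i → f i % d ≡ g i % d) →
              Σℕ f % d ≡ Σℕ g % d
  Σℕ-cong-% {zero}  d f g _  = refl
  Σℕ-cong-% {suc n} d f g f≡g =
    +-cong-% d _ _ _ _ (f≡g fzero) (Σℕ-cong-% d (f ∘ fsuc) (g ∘ fsuc) (f≡g ∘ fsuc))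

  *-odd-% : ∀ m x → x % 2 ≡ 1 → (m * x) % 2 ≡ m % 2
  *-odd-% m x x-odd = begin
    (m * x) % 2             ≡⟨ %-distribˡ-* m x 2 ⟩
    (m % 2 * (x % 2)) % 2   ≡⟨ cong (λ r → (m % 2 * r) % 2) x-odd ⟩
    (m % 2 * 1) % 2         ≡⟨ cong (_% 2) (ℕ.*-identityʳ (m % 2)) ⟩
    m % 2 % 2               ≡⟨ m%n%n≡m%n m 2 ⟩
    m % 2                   ∎
    where open ≡-Reasoning

  ∣Πℕ : ∀ {n d} (f : Fin n → ℕ) i → d ∣ f i → d ∣ Πℕ f
  ∣Πℕ f fzero    d∣ = ∣m⇒∣m*n _ d∣
  ∣Πℕ f (fsuc i) d∣ = ∣n⇒∣m*n (f fzero) (∣Πℕ (f ∘ fsuc) i d∣)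

  quadratic-odd-% : ∀ {n} (a b : Fin n → ℕ) c (x : Fin n → ℕ) → (∀ i → x i % 2 ≡ 1) →
                    quadratic a b c x % 2 ≡ (Σℕ a + Σℕ b + c) % 2
  quadratic-odd-% a b c x x-odd =
    +-cong-% 2 (Σ² + Σ¹) (Σℕ a + Σℕ b) c c
      (+-cong-% 2 Σ² (Σℕ a) Σ¹ (Σℕ b)
        (Σℕ-cong-% 2 _ a λ i →
          trans (*-odd-% (a i * x i) (x i) (x-odd i)) (*-odd-% (a i) (x i) (x-odd i)))
        (Σℕ-cong-% 2 _ b λ i → *-odd-% (b i) (x i) (x-odd i)))
      refl
    where
    Σ² = Σℕ (λ i → a i * x i * x i)
    Σ¹ = Σℕ (λ i → b i * x i)

  2∣Πℕ*quadratic : ∀ {n} (a b : Fin n → ℕ) c (x : Fin n → ℕ) → 2 ∣ Σℕ a + Σℕ b + c →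
                   2 ∣ Πℕ x * quadratic a b c x
  2∣Πℕ*quadratic a b c x 2∣S with any? (λ i → 2 ∣? x i)
  ... | yes (i , 2∣xᵢ) = ∣m⇒∣m*n _ (∣Πℕ x i 2∣xᵢ)
  ... | no  none-even  = ∣n⇒∣m*n (Πℕ x) (m%n≡0⇒n∣m _ 2 (trans
          (quadratic-odd-% a b c x λ i → %2≡1-if-odd (x i) λ 2∣xᵢ → none-even (i , 2∣xᵢ))
          (n∣m⇒m%n≡0 _ 2 2∣S)))

  toℕ-toℤ₈-double : ∀ p q → toℕ (toℤ₈ (2 * p * q)) ≡ (2 * (p * q)) % 8
  toℕ-toℤ₈-double p q = trans (toℕ-fromℕ< _) (cong (_% 8) (ℕ.*-assoc 2 p q))

  4∣[2m]%8 : ∀ {m} → 2 ∣ m → 4 ∣ (2 * m) % 8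
  4∣[2m]%8 2∣m = ℕ.%-presˡ-∣ (ℕ.*-monoʳ-∣ 2 2∣m) (divides 2 refl)

  4∣[2m]%8⇒2∣m : ∀ m → 4 ∣ (2 * m) % 8 → 2 ∣ m
  4∣[2m]%8⇒2∣m m 4∣ = ℕ.*-cancelˡ-∣ 2 (subst (4 ∣_) (sym (m≡m%n+[m/n]*n (2 * m) 8))
    (∣m∣n⇒∣m+n 4∣ (∣n⇒∣m*n ((2 * m) / 8) (divides 2 refl))))

open ValuesOfF

module Faces where

  open import Data.Integer using (_-_)
  open import Data.Integer.Divisibility.Signed using (_∣_; ∣m∣n⇒∣m-n)

  -- The corners of the face {t₁} × {0,1} × {t₃} × {0,1} are listed as (s₂, s₄) = 00, 10, 01, 11.
  Faces : (ℤ → ℤ → ℤ → ℤ → Set) → (P₄ → ℤ) → Set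
  Faces R u = ∀ t₁ t₃ → R (u (t₁ ∷ false ∷ t₃ ∷ false ∷ [])) (u (t₁ ∷ true ∷ t₃ ∷ false ∷ []))
                          (u (t₁ ∷ false ∷ t₃ ∷ true ∷ [])) (u (t₁ ∷ true ∷ t₃ ∷ true ∷ []))

  infix 4 _∣δ²_
  _∣δ²_ : ℤ → (P₄ → ℤ) → Set
  k ∣δ² u = Faces (λ q₀₀ q₁₀ q₀₁ q₁₁ → k ∣ δ² q₀₀ q₁₀ q₀₁ q₁₁) u

  ∣δ²-cong : ∀ {k} (u w : P₄ → ℤ) → (∀ B → k ∣ u B - w B) → k ∣δ² u → k ∣δ² w
  ∣δ²-cong u w k∣u-w k∣δ²u t₁ t₃ =
    subst (_ ∣_) (difference (q false false) (q true false) (q false true) (q true true)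
                             (r false false) (r true false) (r false true) (r true true))
      (∣m∣n⇒∣m-n (k∣δ²u t₁ t₃) (∣m∣n⇒∣m-n (∣m∣n⇒∣m-n (k∣ true true) (k∣ false true))
                                           (∣m∣n⇒∣m-n (k∣ true false) (k∣ false false))))
    where
    q r : Bool → Bool → ℤ
    q s₂ s₄ = u (t₁ ∷ s₂ ∷ t₃ ∷ s₄ ∷ [])
    r s₂ s₄ = w (t₁ ∷ s₂ ∷ t₃ ∷ s₄ ∷ [])
    k∣ : ∀ s₂ s₄ → _ ∣ q s₂ s₄ - r s₂ s₄
    k∣ s₂ s₄ = k∣u-w (t₁ ∷ s₂ ∷ t₃ ∷ s₄ ∷ [])
    difference : ∀ q₀₀ q₁₀ q₀₁ q₁₁ r₀₀ r₁₀ r₀₁ r₁₁ →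
      ((q₁₁ - q₀₁) - (q₁₀ - q₀₀)) - (((q₁₁ - r₁₁) - (q₀₁ - r₀₁)) - ((q₁₀ - r₁₀) - (q₀₀ - r₀₀)))
        ≡ (r₁₁ - r₀₁) - (r₁₀ - r₀₀)
    difference = solve-∀

  record GradedFaces (f : P₄ → ℕ) : Set where
    constructor gradedFaces
    field faces : Faces Graded (λ B → + f B)

  open GradedFaces public

  graded-*ℕ : ∀ {a₀₀ a₁₀ a₀₁ a₁₁ b₀₀ b₁₀ b₀₁ b₁₁} →
    Graded (+ a₀₀) (+ a₁₀) (+ a₀₁) (+ a₁₁) → Graded (+ b₀₀) (+ b₁₀) (+ b₀₁) (+ b₁₁) →
    Graded (+ (a₀₀ ℕ.* b₀₀)) (+ (a₁₀ ℕ.* b₁₀)) (+ (a₀₁ ℕ.* b₀₁)) (+ (a₁₁ ℕ.* b₁₁))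
  graded-*ℕ {a₀₀} {a₁₀} {a₀₁} {a₁₁} {b₀₀} {b₁₀} {b₀₁} {b₁₁}
    rewrite pos-* a₀₀ b₀₀ | pos-* a₁₀ b₁₀ | pos-* a₀₁ b₀₁ | pos-* a₁₁ b₁₁ = graded-*

  gradedFaces-const : ∀ c → GradedFaces (λ _ → c)
  gradedFaces-const c = gradedFaces λ _ _ → graded-const (+ c)

  gradedFaces-+ : ∀ {f g} → GradedFaces f → GradedFaces g → GradedFaces (λ B → f B ℕ.+ g B)
  gradedFaces-+ f-graded g-graded =
    gradedFaces λ t₁ t₃ → graded-+ (faces f-graded t₁ t₃) (faces g-graded t₁ t₃)

  gradedFaces-* : ∀ {f g} → GradedFaces f → GradedFaces g → GradedFaces (λ B → f B ℕ.* g B)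
  gradedFaces-* f-graded g-graded =
    gradedFaces λ t₁ t₃ → graded-*ℕ (faces f-graded t₁ t₃) (faces g-graded t₁ t₃)

  gradedFaces-Σ : ∀ {n} (f : P₄ → Fin n → ℕ) → (∀ i → GradedFaces (λ B → f B i)) →
                  GradedFaces (λ B → Σℕ (f B))
  gradedFaces-Σ {zero}  f _        = gradedFaces-const 0
  gradedFaces-Σ {suc n} f f-graded =
    gradedFaces-+ (f-graded fzero) (gradedFaces-Σ (λ B i → f B (fsuc i)) (f-graded ∘ fsuc))

  gradedFaces-Π : ∀ {n} (f : P₄ → Fin n → ℕ) → (∀ i → GradedFaces (λ B → f B i)) →
                  GradedFaces (λ B → Πℕ (f B))
  gradedFaces-Π {zero}  f _        = gradedFaces-const 1
  gradedFaces-Π {suc n} f f-graded =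
    gradedFaces-* (f-graded fzero) (gradedFaces-Π (λ B i → f B (fsuc i)) (f-graded ∘ fsuc))

  gradedFaces-quadratic : ∀ {n} (a b : Fin n → ℕ) c (x : P₄ → Fin n → ℕ) →
    (∀ i → GradedFaces (λ B → x B i)) → GradedFaces (λ B → quadratic a b c (x B))
  gradedFaces-quadratic a b c x x-graded =
    gradedFaces-+
      (gradedFaces-+
        (gradedFaces-Σ _ λ i →
          gradedFaces-* (gradedFaces-* (gradedFaces-const (a i)) (x-graded i)) (x-graded i))
        (gradedFaces-Σ _ λ i → gradedFaces-* (gradedFaces-const (b i)) (x-graded i)))
      (gradedFaces-const c)

open Faces

module CoordinatesOfZAndM where

  open import Data.Integer using (_*_)
  open import Data.Integer.Divisibility.Signed
    using (_∣_; divides; ∣ᵤ⇒∣; ∣⇒∣ᵤ; ∣-refl; ∣-trans; ∣m∣n⇒∣m-n; ∣m+n∣n⇒∣m; ∣m⇒∣-m; ∣m⇒∣m*n; ∣n⇒∣m*n)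

  entry : Tuple → P₄ → ℤ
  entry x B = + toℕ (x B)

  coord≡möbius : ∀ x A → coord x A ≡ möbius (entry x) A
  coord≡möbius x = alternatingSum≡möbius (entry x)

  ∣-from-≡0 : ∀ {m z} → z ≡[mod m ] + 0 → + m ∣ z
  ∣-from-≡0 {z = z} z≡0 = subst (_ ∣_) (+-identityʳ z) (∣ᵤ⇒∣ z≡0)

  ≡0-from-∣ : ∀ {m z} → + m ∣ z → z ≡[mod m ] + 0
  ≡0-from-∣ {z = z} m∣z = ∣⇒∣ᵤ (subst (_ ∣_) (sym (+-identityʳ z)) m∣z)

  2∣4 : + 2 ∣ + 4
  2∣4 = divides (+ 2) refl

  4∣8 : + 4 ∣ + 8
  4∣8 = divides (+ 2) refl

  2∣-from-≡2*-mod4 : ∀ {u v} → u ≡[mod 4 ] + 2 * v → + 2 ∣ u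
  2∣-from-≡2*-mod4 {u} {v} u≡2v = ∣m+n∣n⇒∣m (∣-trans 2∣4 (∣ᵤ⇒∣ u≡2v)) (∣m⇒∣-m (∣m⇒∣m*n v ∣-refl))

  ⁅2,4⁆⊆ : ∀ b₁ b₃ → (⁅ e2 ⁆ ∪ ⁅ e4 ⁆) ⊆ (b₁ ∷ true ∷ b₃ ∷ true ∷ [])
  ⁅2,4⁆⊆ _ _ (there here)                 = there here
  ⁅2,4⁆⊆ _ _ (there (there (there here))) = there (there (there here))

  module CoordinatesOfZ (x : Tuple) (x∈Z : InZ x) where

    private
      a : P₄ → ℤ
      a = möbius (entry x)

      even : ∀ A → 2 ≤ ∣ A ∣ → + 2 ∣ a A
      even A 2≤∣A∣ = subst (_ ∣_) (coord≡möbius x A) (∣-from-≡0 (proj₁ (proj₂ x∈Z) A 2≤∣A∣))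

      2≤ : ∀ {k} → 2 ≤ suc (suc k)
      2≤ = s≤s (s≤s z≤n)

    even-∋2 : ∀ b A → + 2 ∣ a (b ∷ true ∷ A)
    even-∋2 true  A                    = even (true ∷ true ∷ A) 2≤
    even-∋2 false (true ∷ b₄ ∷ [])     = even (false ∷ true ∷ true ∷ b₄ ∷ []) 2≤
    even-∋2 false (false ∷ true ∷ [])  = even (false ∷ true ∷ false ∷ true ∷ []) 2≤
    even-∋2 false (false ∷ false ∷ []) =
      subst (_ ∣_) (coord≡möbius x ⁅ e2 ⁆) (2∣-from-≡2*-mod4 (proj₁ (proj₁ x∈Z)))

    even-∋4 : ∀ b₁ b₂ b₃ → + 2 ∣ a (b₁ ∷ b₂ ∷ b₃ ∷ true ∷ [])
    even-∋4 b₁    true  b₃    = even-∋2 b₁ (b₃ ∷ true ∷ [])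
    even-∋4 true  false true  = even (true ∷ false ∷ true ∷ true ∷ []) 2≤
    even-∋4 true  false false = even (true ∷ false ∷ false ∷ true ∷ []) 2≤
    even-∋4 false false true  = even (false ∷ false ∷ true ∷ true ∷ []) 2≤
    even-∋4 false false false =
      subst (_ ∣_) (coord≡möbius x ⁅ e4 ⁆) (2∣-from-≡2*-mod4 (proj₂ (proj₁ x∈Z)))

    4∣-∋2,4 : ∀ b₁ b₃ → + 4 ∣ a (b₁ ∷ true ∷ b₃ ∷ true ∷ [])
    4∣-∋2,4 b₁ b₃ =
      ∣-trans 4∣8 (subst (_ ∣_) (coord≡möbius x A)
                         (∣-from-≡0 (proj₂ (proj₂ (proj₂ x∈Z)) A (⁅2,4⁆⊆ b₁ b₃))))
      where A = b₁ ∷ true ∷ b₃ ∷ true ∷ []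

  Z⇒gradedFaces : ∀ {x} → InZ x → GradedFaces (λ B → toℕ (x B))
  Z⇒gradedFaces {x} x∈Z = gradedFaces λ t₁ t₃ → graded-from-∣ (edge₂ t₁ t₃) (edge₄ t₁ t₃) (second t₁ t₃)
    where
    open CoordinatesOfZ x x∈Z
    v = entry x

    edge₂ : ∀ t₁ t₃ → + 2 ∣ Δ (v ∘ (t₁ ∷_)) (t₃ ∷ false ∷ [])
    edge₂ t₁ t₃ =
      Δ-∣ (v ∘ (t₁ ∷_)) (λ A → restrict-∣ v (true ∷ A) (λ b₁ → even-∋2 b₁ A) t₁) (t₃ ∷ false ∷ [])

    edge₄ : ∀ t₁ t₃ → + 2 ∣ möbius (λ B → v (t₁ ∷ false ∷ t₃ ∷ B)) (true ∷ [])
    edge₄ t₁ t₃ =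
      restrict-∣ (λ B → v (t₁ ∷ false ∷ B)) (true ∷ []) (λ b₃ →
        restrict-∣ (v ∘ (t₁ ∷_)) (b₃ ∷ true ∷ []) (λ b₂ →
          restrict-∣ v (b₂ ∷ b₃ ∷ true ∷ []) (λ b₁ → even-∋4 b₁ b₂ b₃) t₁) false) t₃

    second : ∀ t₁ t₃ → + 4 ∣ Δ (Δ (v ∘ (t₁ ∷_)) ∘ (t₃ ∷_)) []
    second t₁ t₃ = Δ-∣ (Δ (v ∘ (t₁ ∷_)) ∘ (t₃ ∷_)) (λ { [] →
      restrict-∣ (Δ (v ∘ (t₁ ∷_))) (true ∷ []) (λ b₃ →
        subst (_ ∣_) (sym (möbius-Δ (v ∘ (t₁ ∷_)) (b₃ ∷ true ∷ [])))
          (restrict-∣ v (true ∷ b₃ ∷ true ∷ []) (λ b₁ → 4∣-∋2,4 b₁ b₃) t₁)) t₃ }) []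

  M-from-∣ : ∀ y → (∀ B → + 4 ∣ entry y B) → + 8 ∣δ² entry y → InM y
  M-from-∣ y 4∣entries 8∣δ² =
    ((z1 ⁅ e1 ⁆ ⁅ e2 ⁆ , z1 ⁅ e3 ⁆ ⁅ e4 ⁆) ,
     (λ A _ → ≡0-from-∣ (∣-trans 2∣4 (4∣a A))) ,
     (λ A _ _ → ≡0-from-∣ (4∣a A)) ,
     z4) ,
    ≡0-from-∣ (4∣a (⁅ e1 ⁆ ∪ ⁅ e3 ⁆))
    where
    v = entry y

    4∣a : ∀ A → + 4 ∣ coord y A
    4∣a A = subst (_ ∣_) (sym (coord≡möbius y A)) (coordinates-∣ v 4∣entries A)

    z1 : ∀ A₁ A₂ → coord y A₂ ≡[mod 4 ] + 2 * coord y A₁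
    z1 A₁ A₂ = ∣⇒∣ᵤ (∣m∣n⇒∣m-n (4∣a A₂) (∣n⇒∣m*n (+ 2) (4∣a A₁)))

    8∣-∋2,4 : ∀ b₁ b₃ → + 8 ∣ möbius v (b₁ ∷ true ∷ b₃ ∷ true ∷ [])
    8∣-∋2,4 b₁ b₃ = extend-∣ v (true ∷ b₃ ∷ true ∷ []) (λ t₁ →
      subst (_ ∣_) (möbius-Δ (v ∘ (t₁ ∷_)) (b₃ ∷ true ∷ []))
        (extend-∣ (Δ (v ∘ (t₁ ∷_))) (true ∷ []) (λ t₃ →
          subst (_ ∣_) (möbius-Δ (Δ (v ∘ (t₁ ∷_)) ∘ (t₃ ∷_)) []) (8∣δ² t₁ t₃)) b₃)) b₁

    z4 : ∀ A → (⁅ e2 ⁆ ∪ ⁅ e4 ⁆) ⊆ A → coord y A ≡[mod 8 ] + 0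
    z4 A@(b₁ ∷ _ ∷ b₃ ∷ _ ∷ []) ⁅2,4⁆⊆A with ⁅2,4⁆⊆A (there here) | ⁅2,4⁆⊆A (there (there (there here)))
    ... | there here | there (there (there here)) =
      ≡0-from-∣ (subst (_ ∣_) (sym (coord≡möbius y A)) (8∣-∋2,4 b₁ b₃))

open CoordinatesOfZAndM

module Witnesses where

  open import Data.Integer using (_-_; _*_)

  ∀-subset? : ∀ {n} {P : Subset n → Set} → (∀ A → Dec (P A)) → Dec (∀ A → P A)
  ∀-subset? P? = map′ (λ ∄¬P A → decidable-stable (P? A) (λ ¬PA → ∄¬P (A , ¬PA)))
                      (λ ∀P (A , ¬PA) → ¬PA (∀P A))
                      (¬? (anySubset? (¬? ∘ P?)))

  ≡[mod]? : ∀ a m b → Dec (a ≡[mod m ] b)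
  ≡[mod]? a m b = m ℕ.∣? ℤ.∣ a - b ∣

  inM? : ∀ x → Dec (InM x)
  inM? x =
    ((≡[mod]? (coord x ⁅ e2 ⁆) 4 (+ 2 * coord x ⁅ e1 ⁆) ×-dec
      ≡[mod]? (coord x ⁅ e4 ⁆) 4 (+ 2 * coord x ⁅ e3 ⁆)) ×-dec
     ∀-subset? (λ A → 2 ≤? ∣ A ∣ →-dec ≡[mod]? (coord x A) 2 (+ 0)) ×-dec
     ∀-subset? (λ A → 2 ≤? ∣ A ∣ →-dec nonempty? _ →-dec ≡[mod]? (coord x A) 4 (+ 0)) ×-dec
     ∀-subset? (λ A → _ ⊆? A →-dec ≡[mod]? (coord x A) 8 (+ 0))) ×-dec
    ≡[mod]? (coord x (⁅ e1 ⁆ ∪ ⁅ e3 ⁆)) 4 (+ 0)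

  r₁₂ r₃₄ const₁ : Tuple
  r₁₂ (b₁ ∷ b₂ ∷ _ ∷ _ ∷ []) = toℤ₈ ((if b₁ then 1 else 0) ℕ.+ (if b₂ then 2 else 0))
  r₃₄ (_ ∷ _ ∷ b₃ ∷ b₄ ∷ []) = toℤ₈ ((if b₃ then 1 else 0) ℕ.+ (if b₄ then 2 else 0))
  const₁ _ = toℤ₈ 1

  r₁₂∈M : InM r₁₂
  r₁₂∈M = from-yes (inM? r₁₂)

  r₃₄∈M : InM r₃₄
  r₃₄∈M = from-yes (inM? r₃₄)

  const₁∈M : InM const₁
  const₁∈M = from-yes (inM? const₁)

open Witnesses

module Forward where

  open import Data.Integer using (_+_; _-_; _*_)
  open import Data.Integer.Divisibility.Signed using (_∣_; divides; ∣ᵤ⇒∣)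

  ∣-minus-% : ∀ m d .{{_ : NonZero d}} → + d ∣ + m - + (m % d)
  ∣-minus-% m d = divides (+ (m / d)) (begin
    + m - + (m % d)                         ≡⟨ cong (_- + (m % d)) (cong +_ (m≡m%n+[m/n]*n m d)) ⟩
    + (m % d) + + (m / d ℕ.* d) - + (m % d) ≡⟨ cong (λ k → + (m % d) + k - + (m % d)) (pos-* (m / d) d) ⟩
    + (m % d) + + (m / d) * + d - + (m % d) ≡⟨ cancel (+ (m % d)) (+ (m / d) * + d) ⟩
    + (m / d) * + d                         ∎)
    where
    open ≡-Reasoning
    cancel : ∀ r s → r + s - r ≡ s
    cancel = solve-∀

  preserves-if-even : ∀ n (a b : Fin n → Fin 2) c →
    2 ℕ.∣ Σℕ (λ i → toℕ (a i)) ℕ.+ Σℕ (λ i → toℕ (b i)) ℕ.+ toℕ c → Preserves (fOp n a b c) InM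
  preserves-if-even n a b c S-even r r∈M = M-from-∣ y 4∣entries 8∣δ²
    where
    a′ b′ : Fin n → ℕ
    a′ i = toℕ (a i)
    b′ i = toℕ (b i)

    x : P₄ → Fin n → ℕ
    x B i = toℕ (r i B)

    P Q : P₄ → ℕ
    P B = Πℕ (x B)
    Q B = quadratic a′ b′ (toℕ c) (x B)

    y : Tuple
    y B = fOp n a b c (λ i → r i B)

    4∣entries : ∀ B → + 4 ∣ entry y B
    4∣entries B = ∣ᵤ⇒∣ (subst (4 ℕ.∣_) (sym (toℕ-toℤ₈-double (P B) (Q B)))
                          (4∣[2m]%8 (2∣Πℕ*quadratic a′ b′ (toℕ c) (x B) S-even)))

    PQ-graded : GradedFaces (λ B → P B ℕ.* Q B)
    PQ-graded = gradedFaces-* (gradedFaces-Π x x-graded) (gradedFaces-quadratic a′ b′ (toℕ c) x x-graded)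
      where
      x-graded : ∀ i → GradedFaces (λ B → x B i)
      x-graded i = Z⇒gradedFaces (proj₁ (r∈M i))

    8∣2PQ-y : ∀ B → + 8 ∣ + 2 * + (P B ℕ.* Q B) - entry y B
    8∣2PQ-y B rewrite toℕ-toℤ₈-double (P B) (Q B) | sym (pos-* 2 (P B ℕ.* Q B)) =
      ∣-minus-% (2 ℕ.* (P B ℕ.* Q B)) 8

    8∣δ² : + 8 ∣δ² entry y
    8∣δ² = ∣δ²-cong (λ B → + 2 * + (P B ℕ.* Q B)) (entry y) 8∣2PQ-y
                    (λ t₁ t₃ → 8∣δ²-double (faces PQ-graded t₁ t₃))

open Forward

module Backward where

  open import Data.Integer using (_-_)
  open import Data.Integer.Divisibility.Signed using (_∣_; ∣⇒∣ᵤ)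

  Πℕ-ones : ∀ {n} (x : Fin n → ℕ) → (∀ i → x i ≡ 1) → Πℕ x ≡ 1
  Πℕ-ones {zero}  x _   = refl
  Πℕ-ones {suc n} x x≡1 = cong₂ ℕ._*_ (x≡1 fzero) (Πℕ-ones (x ∘ fsuc) (x≡1 ∘ fsuc))

  Σℕ-cong : ∀ {n} (f g : Fin n → ℕ) → (∀ i → f i ≡ g i) → Σℕ f ≡ Σℕ g
  Σℕ-cong {zero}  f g _   = refl
  Σℕ-cong {suc n} f g f≡g = cong₂ ℕ._+_ (f≡g fzero) (Σℕ-cong (f ∘ fsuc) (g ∘ fsuc) (f≡g ∘ fsuc))

  Πℕ*quadratic-ones : ∀ {n} (a b : Fin n → ℕ) c (x : Fin n → ℕ) → (∀ i → x i ≡ 1) →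
                      Πℕ x ℕ.* quadratic a b c x ≡ Σℕ a ℕ.+ Σℕ b ℕ.+ c
  Πℕ*quadratic-ones a b c x x≡1 rewrite Πℕ-ones x x≡1 =
    trans (ℕ.*-identityˡ _) (cong₂ (λ s t → s ℕ.+ t ℕ.+ c)
      (Σℕ-cong _ a λ i → trans (cong (λ t → a i ℕ.* t ℕ.* t) (x≡1 i))
                               (trans (ℕ.*-identityʳ _) (ℕ.*-identityʳ _)))
      (Σℕ-cong _ b λ i → trans (cong (b i ℕ.*_) (x≡1 i)) (ℕ.*-identityʳ _)))

  even-if-preserves : ∀ {n} → 2 ≤ n → ∀ (a b : Fin n → Fin 2) c → Preserves (fOp n a b c) InM →
                      2 ℕ.∣ Σℕ (λ i → toℕ (a i)) ℕ.+ Σℕ (λ i → toℕ (b i)) ℕ.+ toℕ c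
  even-if-preserves {suc (suc m)} (s≤s (s≤s _)) a b c preserves =
    4∣[2m]%8⇒2∣m _ (subst (λ s → 4 ℕ.∣ (2 ℕ.* s) % 8) (Πℕ*quadratic-ones a′ b′ (toℕ c) x₁₃ x₁₃≡1)
      (subst (4 ℕ.∣_) (toℕ-toℤ₈-double (Πℕ x₁₃) (quadratic a′ b′ (toℕ c) x₁₃)) (∣⇒∣ᵤ 4∣y₁₃)))
    where
    a′ b′ : Fin (suc (suc m)) → ℕ
    a′ i = toℕ (a i)
    b′ i = toℕ (b i)

    r : Fin (suc (suc m)) → Tuple
    r fzero           = r₁₂
    r (fsuc fzero)    = r₃₄
    r (fsuc (fsuc _)) = const₁

    r∈M : ∀ i → InM (r i)
    r∈M fzero           = r₁₂∈M
    r∈M (fsuc fzero)    = r₃₄∈M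
    r∈M (fsuc (fsuc _)) = const₁∈M

    y : Tuple
    y B = fOp _ a b c (λ i → r i B)

    B₁₃ : P₄
    B₁₃ = ⁅ e1 ⁆ ∪ ⁅ e3 ⁆

    x₁₃ : Fin (suc (suc m)) → ℕ
    x₁₃ i = toℕ (r i B₁₃)

    x₁₃≡1 : ∀ i → x₁₃ i ≡ 1
    x₁₃≡1 fzero           = refl
    x₁₃≡1 (fsuc fzero)    = refl
    x₁₃≡1 (fsuc (fsuc _)) = refl

    -- r₁₂ vanishes at {3} and ∅ and r₃₄ at {1}, so y vanishes at the other three corners
    -- of the face spanned by {1,3}.
    coord-y₁₃ : coord y B₁₃ ≡ entry y B₁₃
    coord-y₁₃ = trans (coord≡möbius y B₁₃) (cancel (entry y B₁₃))
      where
      cancel : ∀ e → (e - + 0) - (+ 0 - + 0) ≡ e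
      cancel = solve-∀

    4∣y₁₃ : + 4 ∣ entry y B₁₃
    4∣y₁₃ = subst (_ ∣_) coord-y₁₃ (∣-from-≡0 (proj₂ (preserves r r∈M)))

open Backward

open import Data.Nat using (ℕ; _≤_; _+_)
open import Data.Nat.Divisibility using (_∣_)
open import Data.Fin using (Fin; toℕ)
open import Function.Bundles using (_⇔_; mk⇔)

lemma3p9 : (n : ℕ) → 2 ≤ n → (a b : Fin n → Fin 2) → (c : Fin 4) →
    2 ∣ (Σℕ (λ i → toℕ (a i)) + Σℕ (λ i → toℕ (b i)) + toℕ c) ⇔ Preserves (fOp n a b c) InM
lemma3p9 n 2≤n a b c = mk⇔ (preserves-if-even n a b c) (even-if-preserves 2≤n a b c)
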